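{- Let $c_n$ be the number of $U_kD$-equivalence classes of the set $\mathcal{L}_n$ of Łukasiewicz paths of length $n$. Then $$\sum_{n\geq0}c_nx^n=\frac{1-x+x^2+\sqrt{1-2x-x^2-2x^3+x^4}}{1-2x-x^3+(1-x)\sqrt{1-2x-x^2-2x^3+x^4}},$$ and $c_n=a_{n+1}$ for all $n\geq 0$, where $a_0=1$ and $a_{m+1}=a_m+\sum_{k=1}^{m-1}a_ka_{m-1-k}$ for $m\geq 0$.
   Context: A Łukasiewicz path of length $n$ is a sequence of $n$ steps from $\{(1,i): i\geq -1\}$ starting at $(0,0)$, ending at $(n,0)$ and never going below the $x$-axis. Write $D=(1,-1)$, $F=(1,0)$, $U_k=(1,k)$ for $k\geq1$. Steps are numbered $1,\dots,n$; an occurrence of $U_kD$ is at position $i$ if its $U_k$ is the $i$-th step. Two Łukasiewicz paths of the same length are $U_kD$-equivalent if for every $k\geq1$ the set of occurrence positions of $U_kD$ is the same in both. -}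

module Defs where

open import Data.Nat using (ℕ; zero; suc; _+_; _*_; _∸_)
open import Data.Bool using (Bool; true; false)
open import Data.List using (List; []; _∷_; _++_; [_]; map; concatMap; upTo; filterᵇ; length; deduplicate)
open import Data.Nat.ListAction using (sum)
open import Data.List.Properties using (≡-dec)
import Data.Nat as N
open import Data.Integer as Z using (ℤ; +_; -[1+_])

-- Steps.  A step (1,i), i ≥ -1, is encoded by the natural number i+1:
--   0 ↦ D = (1,-1),   1 ↦ F = (1,0),   k+1 ↦ U_k = (1,k)  (k ≥ 1).
-- A path is the list of its steps (step 1 first).

Step : Set
Step = ℕ

validFrom : ℕ → List Step → Bool
validFrom zero    []            = true
validFrom (suc _) []            = false
validFrom zero    (zero ∷ _)    = false
validFrom (suc h) (zero ∷ p)    = validFrom h p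
validFrom h       (suc s ∷ p)   = validFrom (h + s) p

isŁukasiewicz : List Step → Bool
isŁukasiewicz = validFrom 0

allLists : ℕ → ℕ → List (List Step)
allLists b zero    = [] ∷ []
allLists b (suc n) = concatMap (λ s → map (s ∷_) (allLists b n)) (upTo (suc b))

-- The set 𝓛ₙ of Łukasiewicz paths of length n (as a list, without
-- repetitions).  Any step U_k of such a path has k ≤ n-1, so
-- encoded steps ≤ n suffice.
Ł : ℕ → List (List Step)
Ł n = filterᵇ isŁukasiewicz (allLists n n)

-- U_kD-signature: the list whose i-th entry is k if an occurrence of
-- U_kD (k ≥ 1) is at position i, and 0 if no U_kD occurs at i.
-- Two paths of the same length are U_kD-equivalent iff they have the
-- same signature.
sig : List Step → List ℕ
sig []                         = []
sig (suc (suc k) ∷ zero ∷ p)   = suc k ∷ sig (zero ∷ p)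
sig (_ ∷ p)                    = 0 ∷ sig p

c : ℕ → ℕ
c n = length (deduplicate (≡-dec N._≟_) (map sig (Ł n)))

nth : List ℕ → ℕ → ℕ
nth []       _       = 0
nth (x ∷ _)  zero    = x
nth (_ ∷ xs) (suc i) = nth xs i

next : ℕ → List ℕ → ℕ
next m l = nth l m + sum (map (λ k → nth l k * nth l (m ∸ 1 ∸ k)) (map suc (upTo (m ∸ 1))))

prefix : ℕ → List ℕ
prefix zero    = 1 ∷ []
prefix (suc m) = prefix m ++ [ next m (prefix m) ]

a : ℕ → ℕ
a m = nth (prefix m) m

Series : Set
Series = ℕ → ℤ

sumTo : ℕ → (ℕ → ℤ) → ℤ
sumTo zero    f = f 0
sumTo (suc n) f = sumTo n f Z.+ f (suc n)

_⋆_ : Series → Series → Series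
(f ⋆ g) n = sumTo n (λ i → f i Z.* g (n ∸ i))

_⊕_ : Series → Series → Series
(f ⊕ g) n = f n Z.+ g n

poly : List ℤ → Series
poly []       _       = + 0
poly (x ∷ _)  zero    = x
poly (_ ∷ xs) (suc i) = poly xs i

radicand : Series
radicand = poly (+ 1 ∷ -[1+ 1 ] ∷ -[1+ 0 ] ∷ -[1+ 1 ] ∷ + 1 ∷ [])

numPoly : Series
numPoly = poly (+ 1 ∷ -[1+ 0 ] ∷ + 1 ∷ [])

denPoly : Series
denPoly = poly (+ 1 ∷ -[1+ 1 ] ∷ + 0 ∷ -[1+ 0 ] ∷ [])

oneMinusX : Series
oneMinusX = poly (+ 1 ∷ -[1+ 0 ] ∷ [])

C : Series
C n = + c n

-- A U_kD-class is determined by its signature, the list carrying k at the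
-- positions where an occurrence of U_kD starts and 0 elsewhere, so c n counts
-- the signatures of paths in 𝓛ₙ.  Reading a signature from right to left, a
-- free position may be a down step and raises the admissible starting height
-- by one, while an occurrence of U_{j+1}D lowers it by j; the signatures of
-- Łukasiewicz paths are exactly the lists for which this capacity exists.
-- An admissible signature of length n + 2 starts with a free position, with
-- U_1D, or with U_{e+2}D followed by t₂, a free position and a block t₁ of
-- capacity e.  This decomposition is unique, so
-- c (n + 2) = c (n + 1) + c n + Σ_{i<n} c i · c (n - 1 - i), the recurrence of
-- a shifted by one.  For C(x) it says (1 - x - x²) C = 1 + x³ C², hence
-- S = 1 - x - x² - 2x³ C satisfies C S = 2 - (1 - x - x²) C, and both series
-- identities follow from this by polynomial arithmetic, using
-- 1 - 2x - x³ = (1 - x)(1 - x - x²) - 2x³.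

module Submission where

open import Defs

module PowerSeries where

  open import Data.Nat as ℕ using (ℕ; zero; suc; _∸_; _≤_; z≤n)
  import Data.Nat.Properties as ℕ
  open import Data.Integer using (ℤ; +_; _+_; _*_)
  import Data.Integer.Properties as ℤ
  open import Data.List using (List; []; _∷_; applyUpTo)
  open import Data.Nat.ListAction using (sum)
  open import Function using (_∘_)
  open import Relation.Binary.PropositionalEquality
  open import Data.Integer.Tactic.RingSolver using (solve-∀)
  open import Algebra.Properties.CommutativeSemigroup ℤ.+-commutativeSemigroup
    using () renaming (interchange to +-interchange)

  sumTo-cong : ∀ n {f g : ℕ → ℤ} → (∀ i → i ≤ n → f i ≡ g i) → sumTo n f ≡ sumTo n g
  sumTo-cong zero    f≡g = f≡g 0 z≤n
  sumTo-cong (suc n) f≡g =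
    cong₂ _+_ (sumTo-cong n (λ i i≤n → f≡g i (ℕ.m≤n⇒m≤1+n i≤n))) (f≡g (suc n) ℕ.≤-refl)

  sumTo-zero : ∀ n {f : ℕ → ℤ} → (∀ i → f i ≡ + 0) → sumTo n f ≡ + 0
  sumTo-zero zero    f≡0 = f≡0 0
  sumTo-zero (suc n) f≡0 = cong₂ _+_ (sumTo-zero n f≡0) (f≡0 (suc n))

  sumTo-+ : ∀ n (f g : ℕ → ℤ) → sumTo n (λ i → f i + g i) ≡ sumTo n f + sumTo n g
  sumTo-+ zero    f g = refl
  sumTo-+ (suc n) f g =
    trans (cong (_+ (f (suc n) + g (suc n))) (sumTo-+ n f g))
          (+-interchange (sumTo n f) (sumTo n g) (f (suc n)) (g (suc n)))

  sumTo-*ˡ : ∀ n k (f : ℕ → ℤ) → sumTo n (λ i → k * f i) ≡ k * sumTo n f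
  sumTo-*ˡ zero    k f = refl
  sumTo-*ˡ (suc n) k f =
    trans (cong (_+ k * f (suc n)) (sumTo-*ˡ n k f)) (sym (ℤ.*-distribˡ-+ k (sumTo n f) (f (suc n))))

  sumTo-unfoldˡ : ∀ n (f : ℕ → ℤ) → sumTo (suc n) f ≡ f 0 + sumTo n (f ∘ suc)
  sumTo-unfoldˡ zero    f = refl
  sumTo-unfoldˡ (suc n) f =
    trans (cong (_+ f (suc (suc n))) (sumTo-unfoldˡ n f)) (ℤ.+-assoc (f 0) _ _)

  sumTo-reverse : ∀ n (f : ℕ → ℤ) → sumTo n f ≡ sumTo n (λ i → f (n ∸ i))
  sumTo-reverse zero    f = refl
  sumTo-reverse (suc n) f = begin
    sumTo n f + f (suc n)                   ≡⟨ cong (_+ f (suc n)) (sumTo-reverse n f) ⟩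
    sumTo n (λ i → f (n ∸ i)) + f (suc n)   ≡⟨ ℤ.+-comm _ (f (suc n)) ⟩
    f (suc n) + sumTo n (λ i → f (n ∸ i))   ≡⟨ sumTo-unfoldˡ n (λ i → f (suc n ∸ i)) ⟨
    sumTo (suc n) (λ i → f (suc n ∸ i))     ∎
    where
    open ≡-Reasoning

  sumTo-applyUpTo : ∀ m (f : ℕ → ℕ) → sumTo m (+_ ∘ f) ≡ + sum (applyUpTo f (suc m))
  sumTo-applyUpTo zero    f = cong +_ (sym (ℕ.+-identityʳ (f 0)))
  sumTo-applyUpTo (suc m) f =
    trans (sumTo-unfoldˡ m (+_ ∘ f))
          (trans (cong (_+_ (+ f 0)) (sumTo-applyUpTo m (f ∘ suc))) (sym (ℤ.pos-+ (f 0) _)))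

  shift : Series → Series
  shift f zero    = + 0
  shift f (suc n) = f n

  shift³ : Series → Series
  shift³ = shift ∘ shift ∘ shift

  scale : ℤ → Series → Series
  scale k f n = k * f n

  one : Series
  one = poly (+ 1 ∷ [])

  -- poly l ⋆ g by Horner's rule, so that its coefficients unfold at symbolic indices.
  infixr 7 _⋆ₚ_

  _⋆ₚ_ : List ℤ → Series → Series
  ([]       ⋆ₚ g) n = + 0
  ((p ∷ ps) ⋆ₚ g) n = p * g n + shift (ps ⋆ₚ g) n

  ⊕-cong : ∀ {f f′ g g′} → f ≗ f′ → g ≗ g′ → (f ⊕ g) ≗ (f′ ⊕ g′)
  ⊕-cong f≗f′ g≗g′ n = cong₂ _+_ (f≗f′ n) (g≗g′ n)

  ⊕-congˡ : ∀ {f f′} g → f ≗ f′ → (f ⊕ g) ≗ (f′ ⊕ g)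
  ⊕-congˡ g f≗f′ n = cong (_+ g n) (f≗f′ n)

  ⊕-congʳ : ∀ f {g g′} → g ≗ g′ → (f ⊕ g) ≗ (f ⊕ g′)
  ⊕-congʳ f g≗g′ n = cong (_+_ (f n)) (g≗g′ n)

  shift-cong : ∀ {f g} → f ≗ g → shift f ≗ shift g
  shift-cong f≗g zero    = refl
  shift-cong f≗g (suc n) = f≗g n

  shift³-cong : ∀ {f g} → f ≗ g → shift³ f ≗ shift³ g
  shift³-cong = shift-cong ∘ shift-cong ∘ shift-cong

  scale-cong : ∀ k {f g} → f ≗ g → scale k f ≗ scale k g
  scale-cong k f≗g n = cong (k *_) (f≗g n)

  ⋆ₚ-cong : ∀ l {f g} → f ≗ g → l ⋆ₚ f ≗ l ⋆ₚ g
  ⋆ₚ-cong []       f≗g n = refl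
  ⋆ₚ-cong (p ∷ ps) f≗g n = cong₂ _+_ (cong (p *_) (f≗g n)) (shift-cong (⋆ₚ-cong ps f≗g) n)

  shift-⊕ : ∀ f g → shift (f ⊕ g) ≗ (shift f ⊕ shift g)
  shift-⊕ f g zero    = refl
  shift-⊕ f g (suc n) = refl

  shift-scale : ∀ k f → shift (scale k f) ≗ scale k (shift f)
  shift-scale k f zero    = sym (ℤ.*-zeroʳ k)
  shift-scale k f (suc n) = refl

  shift³-⊕ : ∀ f g → shift³ (f ⊕ g) ≗ (shift³ f ⊕ shift³ g)
  shift³-⊕ f g n =
    trans (shift-cong (shift-cong (shift-⊕ f g)) n)
          (trans (shift-cong (shift-⊕ (shift f) (shift g)) n) (shift-⊕ (shift (shift f)) (shift (shift g)) n))

  shift³-scale : ∀ k f → shift³ (scale k f) ≗ scale k (shift³ f)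
  shift³-scale k f n =
    trans (shift-cong (shift-cong (shift-scale k f)) n)
          (trans (shift-cong (shift-scale k (shift f)) n) (shift-scale k (shift (shift f)) n))

  scale-⊕ : ∀ k f g → scale k (f ⊕ g) ≗ (scale k f ⊕ scale k g)
  scale-⊕ k f g n = ℤ.*-distribˡ-+ k (f n) (g n)

  ⋆ₚ-⊕ : ∀ l f g → l ⋆ₚ (f ⊕ g) ≗ ((l ⋆ₚ f) ⊕ (l ⋆ₚ g))
  ⋆ₚ-⊕ []       f g n = refl
  ⋆ₚ-⊕ (p ∷ ps) f g n = begin
    p * (f n + g n) + shift (ps ⋆ₚ (f ⊕ g)) n
      ≡⟨ cong₂ _+_ (ℤ.*-distribˡ-+ p (f n) (g n))
                   (trans (shift-cong (⋆ₚ-⊕ ps f g) n) (shift-⊕ (ps ⋆ₚ f) (ps ⋆ₚ g) n)) ⟩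
    (p * f n + p * g n) + (shift (ps ⋆ₚ f) n + shift (ps ⋆ₚ g) n)
      ≡⟨ +-interchange (p * f n) (p * g n) _ _ ⟩
    (p * f n + shift (ps ⋆ₚ f) n) + (p * g n + shift (ps ⋆ₚ g) n) ∎
    where
    open ≡-Reasoning

  ⋆ₚ-scale : ∀ l k f → l ⋆ₚ scale k f ≗ scale k (l ⋆ₚ f)
  ⋆ₚ-scale []       k f n = sym (ℤ.*-zeroʳ k)
  ⋆ₚ-scale (p ∷ ps) k f n =
    trans (cong₂ _+_ (reorder p k (f n))
                     (trans (shift-cong (⋆ₚ-scale ps k f) n) (shift-scale k (ps ⋆ₚ f) n)))
          (sym (ℤ.*-distribˡ-+ k (p * f n) _))
    where
    reorder : ∀ p k x → p * (k * x) ≡ k * (p * x)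
    reorder = solve-∀

  ⋆-comm : ∀ f g → (f ⋆ g) ≗ (g ⋆ f)
  ⋆-comm f g n = trans (sumTo-reverse n _) (sumTo-cong n (λ i i≤n →
    trans (cong (λ j → f (n ∸ i) * g j) (ℕ.m∸[m∸n]≡n i≤n)) (ℤ.*-comm (f (n ∸ i)) (g i))))

  ⋆-congˡ : ∀ {f f′} g → f ≗ f′ → (f ⋆ g) ≗ (f′ ⋆ g)
  ⋆-congˡ g f≗f′ n = sumTo-cong n (λ i _ → cong (_* g (n ∸ i)) (f≗f′ i))

  ⋆-distribʳ-⊕ : ∀ f g h → ((f ⊕ g) ⋆ h) ≗ ((f ⋆ h) ⊕ (g ⋆ h))
  ⋆-distribʳ-⊕ f g h n =
    trans (sumTo-cong n (λ i _ → ℤ.*-distribʳ-+ (h (n ∸ i)) (f i) (g i))) (sumTo-+ n _ _)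

  scale-⋆ : ∀ k f g → (scale k f ⋆ g) ≗ scale k (f ⋆ g)
  scale-⋆ k f g n = trans (sumTo-cong n (λ i _ → ℤ.*-assoc k (f i) (g (n ∸ i)))) (sumTo-*ˡ n k _)

  shift-⋆ : ∀ f g → (shift f ⋆ g) ≗ shift (f ⋆ g)
  shift-⋆ f g zero    = refl
  shift-⋆ f g (suc n) = trans (sumTo-unfoldˡ n _) (ℤ.+-identityˡ _)

  shift³-⋆ : ∀ f g → (shift³ f ⋆ g) ≗ shift³ (f ⋆ g)
  shift³-⋆ f g n =
    trans (shift-⋆ (shift (shift f)) g n)
          (shift-cong (λ m → trans (shift-⋆ (shift f) g m) (shift-cong (shift-⋆ f g) m)) n)

  poly-⋆ : ∀ l g → (poly l ⋆ g) ≗ (l ⋆ₚ g)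
  poly-⋆ []       g n       = sumTo-zero n (λ _ → refl)
  poly-⋆ (p ∷ ps) g zero    = sym (ℤ.+-identityʳ (p * g 0))
  poly-⋆ (p ∷ ps) g (suc n) = trans (sumTo-unfoldˡ n _) (cong (_+_ (p * g (suc n))) (poly-⋆ ps g n))

  ⋆ₚ-⋆ : ∀ l g h → ((l ⋆ₚ g) ⋆ h) ≗ (l ⋆ₚ (g ⋆ h))
  ⋆ₚ-⋆ []       g h n = sumTo-zero n (λ _ → refl)
  ⋆ₚ-⋆ (p ∷ ps) g h n =
    trans (⋆-distribʳ-⊕ (scale p g) (shift (ps ⋆ₚ g)) h n)
          (cong₂ _+_ (scale-⋆ p g h n) (trans (shift-⋆ (ps ⋆ₚ g) h n) (shift-cong (⋆ₚ-⋆ ps g h) n)))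

  one-⋆ : ∀ g → (one ⋆ g) ≗ g
  one-⋆ g zero    = trans (poly-⋆ (+ 1 ∷ []) g 0) (trans (ℤ.+-identityʳ _) (ℤ.*-identityˡ _))
  one-⋆ g (suc n) = trans (poly-⋆ (+ 1 ∷ []) g (suc n)) (trans (ℤ.+-identityʳ _) (ℤ.*-identityˡ _))

module QuadraticEquation where

  open import Data.Nat as ℕ using (ℕ; suc)
  open import Data.Integer using (ℤ; +_; -[1+_]; _+_; _*_)
  import Data.Integer.Properties as ℤ
  open import Data.List using (List; []; _∷_)
  open import Relation.Binary.PropositionalEquality
  open import Relation.Binary.Reasoning.Setoid (ℕ →-setoid ℤ)
  open import Data.Integer.Tactic.RingSolver using (solve-∀)
  open PowerSeries

  1-x : List ℤ
  1-x = + 1 ∷ -[1+ 0 ] ∷ []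

  1-x-x² : List ℤ
  1-x-x² = + 1 ∷ -[1+ 0 ] ∷ -[1+ 0 ] ∷ []

  1-2x-x³ : List ℤ
  1-2x-x³ = + 1 ∷ -[1+ 1 ] ∷ + 0 ∷ -[1+ 0 ] ∷ []

  1-2x-x³-factor : poly 1-2x-x³ ≗ ((1-x ⋆ₚ poly 1-x-x²) ⊕ shift³ (scale -[1+ 1 ] one))
  1-2x-x³-factor 0 = refl
  1-2x-x³-factor 1 = refl
  1-2x-x³-factor 2 = refl
  1-2x-x³-factor 3 = refl
  1-2x-x³-factor (suc (suc (suc (suc n)))) = refl

  1-2x-x³-⋆ₚ : ∀ g → 1-2x-x³ ⋆ₚ g ≗ ((1-x ⋆ₚ (1-x-x² ⋆ₚ g)) ⊕ shift³ (scale -[1+ 1 ] g))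
  1-2x-x³-⋆ₚ g = begin
    1-2x-x³ ⋆ₚ g
      ≈⟨ poly-⋆ 1-2x-x³ g ⟨
    poly 1-2x-x³ ⋆ g
      ≈⟨ ⋆-congˡ g 1-2x-x³-factor ⟩
    ((1-x ⋆ₚ poly 1-x-x²) ⊕ shift³ (scale -[1+ 1 ] one)) ⋆ g
      ≈⟨ ⋆-distribʳ-⊕ (1-x ⋆ₚ poly 1-x-x²) (shift³ (scale -[1+ 1 ] one)) g ⟩
    ((1-x ⋆ₚ poly 1-x-x²) ⋆ g) ⊕ (shift³ (scale -[1+ 1 ] one) ⋆ g)
      ≈⟨ ⊕-cong (⋆ₚ-⋆ 1-x (poly 1-x-x²) g) (shift³-⋆ (scale -[1+ 1 ] one) g) ⟩
    (1-x ⋆ₚ (poly 1-x-x² ⋆ g)) ⊕ shift³ (scale -[1+ 1 ] one ⋆ g)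
      ≈⟨ ⊕-cong (⋆ₚ-cong 1-x (poly-⋆ 1-x-x² g))
                (shift³-cong (λ n → trans (scale-⋆ -[1+ 1 ] one g n) (cong (-[1+ 1 ] *_) (one-⋆ g n)))) ⟩
    (1-x ⋆ₚ (1-x-x² ⋆ₚ g)) ⊕ shift³ (scale -[1+ 1 ] g) ∎

  recurrence⇒equation : ∀ (F : Series) → F 0 ≡ + 1 → F 1 ≡ + 1 → F 2 ≡ + 2 →
                        (∀ m → F (3 ℕ.+ m) ≡ F (2 ℕ.+ m) + F (1 ℕ.+ m) + (F ⋆ F) m) →
                        1-x-x² ⋆ₚ F ≗ (one ⊕ shift³ (F ⋆ F))
  recurrence⇒equation F F₀ F₁ F₂ F-rec 0 rewrite F₀ = refl
  recurrence⇒equation F F₀ F₁ F₂ F-rec 1 rewrite F₀ | F₁ = refl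
  recurrence⇒equation F F₀ F₁ F₂ F-rec 2 rewrite F₀ | F₁ | F₂ = refl
  recurrence⇒equation F F₀ F₁ F₂ F-rec (suc (suc (suc m))) rewrite F-rec m =
    cancel (F (2 ℕ.+ m)) (F (1 ℕ.+ m)) ((F ⋆ F) m)
    where
    -- Both sides of coefficient m + 3, in the shape in which they unfold.
    cancel : ∀ x y q → + 1 * (x + y + q) + (-[1+ 0 ] * x + (-[1+ 0 ] * y + + 0)) ≡ + 0 + q
    cancel = solve-∀

  module QuadraticSolution (F : Series) (F-eq : 1-x-x² ⋆ₚ F ≗ (one ⊕ shift³ (F ⋆ F))) where

    root : Series
    root = poly 1-x-x² ⊕ shift³ (scale -[1+ 1 ] F)

    root-⋆ : ∀ g → (root ⋆ g) ≗ ((1-x-x² ⋆ₚ g) ⊕ shift³ (scale -[1+ 1 ] (F ⋆ g)))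
    root-⋆ g = begin
      root ⋆ g
        ≈⟨ ⋆-distribʳ-⊕ (poly 1-x-x²) (shift³ (scale -[1+ 1 ] F)) g ⟩
      (poly 1-x-x² ⋆ g) ⊕ (shift³ (scale -[1+ 1 ] F) ⋆ g)
        ≈⟨ ⊕-cong (poly-⋆ 1-x-x² g) (λ n → trans (shift³-⋆ (scale -[1+ 1 ] F) g n)
                                                  (shift³-cong (scale-⋆ -[1+ 1 ] F g) n)) ⟩
      (1-x-x² ⋆ₚ g) ⊕ shift³ (scale -[1+ 1 ] (F ⋆ g)) ∎

    root-⋆-F : (root ⋆ F) ≗ (scale (+ 2) one ⊕ scale -[1+ 0 ] (1-x-x² ⋆ₚ F))
    root-⋆-F = begin
      root ⋆ F
        ≈⟨ root-⋆ F ⟩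
      (1-x-x² ⋆ₚ F) ⊕ shift³ (scale -[1+ 1 ] (F ⋆ F))
        ≈⟨ ⊕-cong F-eq (shift³-scale -[1+ 1 ] (F ⋆ F)) ⟩
      (one ⊕ W) ⊕ scale -[1+ 1 ] W
        ≈⟨ (λ n → rearrange (one n) (W n)) ⟩
      scale (+ 2) one ⊕ scale -[1+ 0 ] (one ⊕ W)
        ≈⟨ ⊕-congʳ (scale (+ 2) one) (scale-cong -[1+ 0 ] F-eq) ⟨
      scale (+ 2) one ⊕ scale -[1+ 0 ] (1-x-x² ⋆ₚ F) ∎
      where
      W : Series
      W = shift³ (F ⋆ F)
      rearrange : ∀ o w → (o + w) + -[1+ 1 ] * w ≡ + 2 * o + -[1+ 0 ] * (o + w)
      rearrange = solve-∀

    1-x-x²-⋆ₚ-root :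
      1-x-x² ⋆ₚ root ≗ ((1-x-x² ⋆ₚ poly 1-x-x²) ⊕ shift³ (scale -[1+ 1 ] (1-x-x² ⋆ₚ F)))
    1-x-x²-⋆ₚ-root = begin
      1-x-x² ⋆ₚ root                 ≈⟨ poly-⋆ 1-x-x² root ⟨
      poly 1-x-x² ⋆ root             ≈⟨ ⋆-comm (poly 1-x-x²) root ⟩
      root ⋆ poly 1-x-x²             ≈⟨ root-⋆ (poly 1-x-x²) ⟩
      (1-x-x² ⋆ₚ poly 1-x-x²) ⊕ shift³ (scale -[1+ 1 ] (F ⋆ poly 1-x-x²))
        ≈⟨ ⊕-congʳ (1-x-x² ⋆ₚ poly 1-x-x²) (shift³-cong (scale-cong -[1+ 1 ] (λ n →
             trans (⋆-comm F (poly 1-x-x²) n) (poly-⋆ 1-x-x² F n)))) ⟩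
      (1-x-x² ⋆ₚ poly 1-x-x²) ⊕ shift³ (scale -[1+ 1 ] (1-x-x² ⋆ₚ F)) ∎

    1-x-x²-⋆ₚ-F+F-⋆-root : ((1-x-x² ⋆ₚ F) ⊕ (F ⋆ root)) ≗ scale (+ 2) one
    1-x-x²-⋆ₚ-F+F-⋆-root n =
      trans (cong (_+_ (PF n)) (trans (⋆-comm F root n) (root-⋆-F n))) (cancel (PF n) (+ 2 * one n))
      where
      PF : Series
      PF = 1-x-x² ⋆ₚ F
      cancel : ∀ p t → p + (t + -[1+ 0 ] * p) ≡ t
      cancel = solve-∀

    root-squared : (root ⋆ root) ≗ radicand
    root-squared = begin
      root ⋆ root
        ≈⟨ root-⋆ root ⟩
      (1-x-x² ⋆ₚ root) ⊕ shift³ (scale -[1+ 1 ] (F ⋆ root))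
        ≈⟨ ⊕-congˡ (shift³ (scale -[1+ 1 ] (F ⋆ root))) 1-x-x²-⋆ₚ-root ⟩
      (P² ⊕ shift³ (scale -[1+ 1 ] PF)) ⊕ shift³ (scale -[1+ 1 ] (F ⋆ root))
        ≈⟨ (λ n → ℤ.+-assoc (P² n) _ _) ⟩
      P² ⊕ (shift³ (scale -[1+ 1 ] PF) ⊕ shift³ (scale -[1+ 1 ] (F ⋆ root)))
        ≈⟨ ⊕-congʳ P² (λ n → trans (shift³-cong (scale-⊕ -[1+ 1 ] PF (F ⋆ root)) n)
                                   (shift³-⊕ (scale -[1+ 1 ] PF) (scale -[1+ 1 ] (F ⋆ root)) n)) ⟨
      P² ⊕ shift³ (scale -[1+ 1 ] (PF ⊕ (F ⋆ root)))
        ≈⟨ ⊕-congʳ P² (shift³-cong (scale-cong -[1+ 1 ] 1-x-x²-⋆ₚ-F+F-⋆-root)) ⟩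
      P² ⊕ shift³ (scale -[1+ 1 ] (scale (+ 2) one))
        ≈⟨ expand ⟩
      radicand ∎
      where
      P² PF : Series
      P² = 1-x-x² ⋆ₚ poly 1-x-x²
      PF = 1-x-x² ⋆ₚ F
      expand : (P² ⊕ shift³ (scale -[1+ 1 ] (scale (+ 2) one))) ≗ radicand
      expand 0 = refl
      expand 1 = refl
      expand 2 = refl
      expand 3 = refl
      expand 4 = refl
      expand 5 = refl
      expand (suc (suc (suc (suc (suc (suc n)))))) = refl

    root-equation : (F ⋆ (denPoly ⊕ (oneMinusX ⋆ root))) ≗ (numPoly ⊕ root)
    root-equation = begin
      F ⋆ (denPoly ⊕ (oneMinusX ⋆ root))
        ≈⟨ ⋆-comm F (denPoly ⊕ (oneMinusX ⋆ root)) ⟩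
      (denPoly ⊕ (oneMinusX ⋆ root)) ⋆ F
        ≈⟨ ⋆-distribʳ-⊕ denPoly (oneMinusX ⋆ root) F ⟩
      (denPoly ⋆ F) ⊕ ((oneMinusX ⋆ root) ⋆ F)
        ≈⟨ ⊕-cong (poly-⋆ 1-2x-x³ F)
                  (λ n → trans (⋆-congˡ F (poly-⋆ 1-x root) n) (⋆ₚ-⋆ 1-x root F n)) ⟩
      (1-2x-x³ ⋆ₚ F) ⊕ (1-x ⋆ₚ (root ⋆ F))
        ≈⟨ ⊕-cong (1-2x-x³-⋆ₚ F) (⋆ₚ-cong 1-x root-⋆-F) ⟩
      ((1-x ⋆ₚ PF) ⊕ G) ⊕ (1-x ⋆ₚ (scale (+ 2) one ⊕ scale -[1+ 0 ] PF))
        ≈⟨ ⊕-congʳ ((1-x ⋆ₚ PF) ⊕ G)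
             (λ n → trans (⋆ₚ-⊕ 1-x (scale (+ 2) one) (scale -[1+ 0 ] PF) n)
                          (⊕-congʳ (1-x ⋆ₚ scale (+ 2) one) (⋆ₚ-scale 1-x -[1+ 0 ] PF) n)) ⟩
      ((1-x ⋆ₚ PF) ⊕ G) ⊕ ((1-x ⋆ₚ scale (+ 2) one) ⊕ scale -[1+ 0 ] (1-x ⋆ₚ PF))
        ≈⟨ (λ n → cancel ((1-x ⋆ₚ PF) n) (G n) ((1-x ⋆ₚ scale (+ 2) one) n)) ⟩
      (1-x ⋆ₚ scale (+ 2) one) ⊕ G
        ≈⟨ ⊕-congˡ G expand ⟩
      (numPoly ⊕ poly 1-x-x²) ⊕ G
        ≈⟨ (λ n → ℤ.+-assoc (numPoly n) (poly 1-x-x² n) (G n)) ⟩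
      numPoly ⊕ root ∎
      where
      PF G : Series
      PF = 1-x-x² ⋆ₚ F
      G  = shift³ (scale -[1+ 1 ] F)
      cancel : ∀ x g t → (x + g) + (t + -[1+ 0 ] * x) ≡ t + g
      cancel = solve-∀
      expand : (1-x ⋆ₚ scale (+ 2) one) ≗ (numPoly ⊕ poly 1-x-x²)
      expand 0 = refl
      expand 1 = refl
      expand 2 = refl
      expand (suc (suc (suc n))) = refl

module Capacities where

  open import Data.Nat as ℕ using (ℕ; zero; suc; _+_; _∸_; _≤_; z≤n; s≤s)
  import Data.Nat.Properties as ℕ
  open import Data.Bool using (T; T?)
  open import Data.List using (List; []; _∷_; _++_; length; map; upTo; deduplicate)
  open import Data.List.Properties using (≡-dec)
  open import Data.List.Relation.Unary.All as All using (All; []; _∷_)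
  open import Data.List.Relation.Unary.Any as Any using (here)
  open import Data.List.Membership.Propositional using (_∈_)
  open import Data.List.Membership.Propositional.Properties
  open import Data.List.Relation.Unary.Unique.Propositional using (Unique)
  open import Data.List.Relation.Unary.Unique.DecPropositional.Properties using (deduplicate-!)
  open import Data.Product using (∃; _×_; _,_)
  open import Data.Empty using (⊥-elim)
  open import Function using (_∘_)
  open import Relation.Binary.PropositionalEquality
  open import Algebra.Properties.CommutativeSemigroup ℕ.+-commutativeSemigroup
    using () renaming (x∙yz≈y∙xz to m+[n+o]≡n+[m+o])

  -- Capacity u a b: a segment with signature u can start at any height ≤ a when
  -- the rest of the path can start at any height ≤ b.
  data Capacity : List ℕ → ℕ → ℕ → Set where
    empty : ∀ {a} → Capacity [] a a
    free  : ∀ {u a b} → Capacity u a b → Capacity (0 ∷ u) (suc a) b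
    peak  : ∀ {u a b} j → Capacity u (j + a) b → Capacity (suc j ∷ 0 ∷ u) a b

  Admissible : List ℕ → Set
  Admissible z = ∃ λ m → Capacity z m 0

  capacity-unique : ∀ {u a a′ b} → Capacity u a b → Capacity u a′ b → a ≡ a′
  capacity-unique empty      empty        = refl
  capacity-unique (free r)   (free r′)    = cong suc (capacity-unique r r′)
  capacity-unique (peak j r) (peak .j r′) = ℕ.+-cancelˡ-≡ j _ _ (capacity-unique r r′)

  capacity-++ : ∀ {u v a b c} → Capacity u a b → Capacity v b c → Capacity (u ++ v) a c
  capacity-++ empty      s = s
  capacity-++ (free r)   s = free (capacity-++ r s)
  capacity-++ (peak j r) s = peak j (capacity-++ r s)

  capacity-raise : ∀ {u a b} k → Capacity u a b → Capacity u (k + a) (k + b)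
  capacity-raise k empty = empty
  capacity-raise {a = suc a} k (free r) rewrite ℕ.+-suc k a = free (capacity-raise k r)
  capacity-raise {a = a} k (peak {u} {b = b} j r) =
    peak j (subst (λ x → Capacity u x (k + b)) (m+[n+o]≡n+[m+o] k j a) (capacity-raise k r))

  capacity-≤ : ∀ {u a b} → Capacity u a b → a ≤ b + length u
  capacity-≤ {b = b} empty = ℕ.≤-reflexive (sym (ℕ.+-identityʳ b))
  capacity-≤ {b = b} (free {u} r) =
    ℕ.≤-trans (s≤s (capacity-≤ r)) (ℕ.≤-reflexive (sym (ℕ.+-suc b (length u))))
  capacity-≤ {b = b} (peak {u} {a} j r) =
    ℕ.≤-trans (ℕ.m≤n+m a j) (ℕ.≤-trans (capacity-≤ r) (ℕ.+-monoʳ-≤ b (ℕ.m≤n⇒m≤o+n 2 ℕ.≤-refl)))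

  capacityOf : List ℕ → ℕ
  capacityOf []                 = 0
  capacityOf (zero ∷ t)         = suc (capacityOf t)
  capacityOf (suc j ∷ zero ∷ t) = capacityOf t ∸ j
  capacityOf (suc j ∷ _)        = 0

  capacityOf-correct : ∀ {t m} → Capacity t m 0 → capacityOf t ≡ m
  capacityOf-correct empty    = refl
  capacityOf-correct (free r) = cong suc (capacityOf-correct r)
  capacityOf-correct {m = m} (peak j r) rewrite capacityOf-correct r = ℕ.m+n∸m≡n j m

  validFrom-up : ∀ h s p → validFrom h (suc s ∷ p) ≡ validFrom (h + s) p
  validFrom-up zero    s p = refl
  validFrom-up (suc h) s p = refl

  validFrom⇒capacity : ∀ h p → T (validFrom h p) → ∃ λ m → h ≤ m × Capacity (sig p) m 0
  validFrom⇒capacity zero    []         _ = 0 , z≤n , empty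
  validFrom⇒capacity (suc h) (zero ∷ p) v with validFrom⇒capacity h p v
  ... | m , h≤m , r = suc m , s≤s h≤m , free r
  validFrom⇒capacity h (suc zero ∷ p) v
    with validFrom⇒capacity (h + 0) p (subst T (validFrom-up h 0 p) v)
  ... | m , h≤m , r = suc m , ℕ.m≤n⇒m≤1+n (subst (_≤ m) (ℕ.+-identityʳ h) h≤m) , free r
  validFrom⇒capacity h (suc (suc k) ∷ []) v rewrite validFrom-up h (suc k) [] | ℕ.+-suc h k = ⊥-elim v
  validFrom⇒capacity h (suc (suc k) ∷ zero ∷ p) v
    rewrite validFrom-up h (suc k) (zero ∷ p) | ℕ.+-suc h k with validFrom⇒capacity (h + k) p v
  ... | m , h+k≤m , r =
    m ∸ k , subst (_≤ m ∸ k) (ℕ.m+n∸n≡m h k) (ℕ.∸-monoˡ-≤ k h+k≤m) ,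
    peak k (subst (λ x → Capacity (sig p) x 0) (sym (ℕ.m+[n∸m]≡n (ℕ.≤-trans (ℕ.m≤n+m k h) h+k≤m))) r)
  validFrom⇒capacity h (suc (suc k) ∷ suc s ∷ p) v
    with validFrom⇒capacity (h + suc k) (suc s ∷ p) (subst T (validFrom-up h (suc k) (suc s ∷ p)) v)
  ... | m , h+1+k≤m , r = suc m , ℕ.m≤n⇒m≤1+n (ℕ.≤-trans (ℕ.m≤m+n h (suc k)) h+1+k≤m) , free r

  -- Free positions are realised by D above the axis and by F on it, so none of
  -- them starts an occurrence of U_kD.
  capacity⇒validFrom : ∀ {z m} h → Capacity z m 0 → h ≤ m →
                       ∃ λ p → T (validFrom h p) × sig p ≡ z × All (_≤ length z) p
  capacity⇒validFrom zero empty _ = [] , _ , refl , []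
  capacity⇒validFrom zero (free r) _ with capacity⇒validFrom zero r z≤n
  ... | p , v , refl , bounded = 1 ∷ p , v , refl , s≤s z≤n ∷ All.map ℕ.m≤n⇒m≤1+n bounded
  capacity⇒validFrom (suc h) (free r) (s≤s h≤m) with capacity⇒validFrom h r h≤m
  ... | p , v , refl , bounded = 0 ∷ p , v , refl , z≤n ∷ All.map ℕ.m≤n⇒m≤1+n bounded
  capacity⇒validFrom {m = m} h (peak j r) h≤m
    with capacity⇒validFrom (h + j) r (subst (_≤ j + m) (ℕ.+-comm j h) (ℕ.+-monoʳ-≤ j h≤m))
  ... | p , v , refl , bounded =
    suc (suc j) ∷ 0 ∷ p ,
    subst T (sym (trans (validFrom-up h (suc j) (0 ∷ p))
                        (cong (λ x → validFrom x (0 ∷ p)) (ℕ.+-suc h j)))) v ,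
    refl ,
    s≤s (s≤s (ℕ.≤-trans (ℕ.m≤m+n j m) (capacity-≤ r))) ∷ z≤n ∷ All.map (ℕ.m≤n⇒m≤o+n 2) bounded

  length-sig : ∀ p → length (sig p) ≡ length p
  length-sig []                       = refl
  length-sig (zero ∷ p)               = cong suc (length-sig p)
  length-sig (suc zero ∷ p)           = cong suc (length-sig p)
  length-sig (suc (suc k) ∷ [])       = refl
  length-sig (suc (suc k) ∷ zero ∷ p) = cong suc (length-sig (zero ∷ p))
  length-sig (suc (suc k) ∷ suc s ∷ p) = cong suc (length-sig (suc s ∷ p))

  ∈-allLists⁺ : ∀ b p → All (_≤ b) p → p ∈ allLists b (length p)
  ∈-allLists⁺ b []      []           = here refl
  ∈-allLists⁺ b (s ∷ p) (s≤b ∷ p≤b) =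
    ∈-concatMap⁺ (λ s → map (s ∷_) (allLists b (length p)))
      (Any.map (λ { refl → ∈-map⁺ (s ∷_) (∈-allLists⁺ b p p≤b) }) (∈-upTo⁺ (s≤s s≤b)))

  ∈-allLists⁻ : ∀ b n {p} → p ∈ allLists b n → length p ≡ n
  ∈-allLists⁻ b zero    (here refl) = refl
  ∈-allLists⁻ b (suc n) p∈
    with _ , s∷p∈ ←
           Any.satisfied (∈-concatMap⁻ (λ s → map (s ∷_) (allLists b n)) {xs = upTo (suc b)} p∈)
    with _ , p∈′ , refl ← ∈-map⁻ _ s∷p∈
    = cong suc (∈-allLists⁻ b n p∈′)

  signatures : ℕ → List (List ℕ)
  signatures n = deduplicate (≡-dec ℕ._≟_) (map sig (Ł n))

  signatures-unique : ∀ n → Unique (signatures n)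
  signatures-unique n = deduplicate-! (≡-dec ℕ._≟_) (map sig (Ł n))

  ∈-signatures⁻ : ∀ n {z} → z ∈ signatures n → length z ≡ n × Admissible z
  ∈-signatures⁻ n z∈
    with p , p∈ , refl ← ∈-map⁻ sig (∈-deduplicate⁻ (≡-dec ℕ._≟_) (map sig (Ł n)) z∈)
    with p∈all , valid ← ∈-filter⁻ (T? ∘ isŁukasiewicz) {xs = allLists n n} p∈
    with m , _ , r ← validFrom⇒capacity 0 p valid
    = trans (length-sig p) (∈-allLists⁻ n n p∈all) , m , r

  ∈-signatures⁺ : ∀ {z} → Admissible z → z ∈ signatures (length z)
  ∈-signatures⁺ (m , r) with p , valid , refl , bounded ← capacity⇒validFrom 0 r z≤n =
    ∈-deduplicate⁺ (≡-dec ℕ._≟_)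
      (∈-map⁺ sig (∈-filter⁺ (T? ∘ isŁukasiewicz)
        (subst (λ k → p ∈ allLists (length (sig p)) k) (sym (length-sig p)) (∈-allLists⁺ _ p bounded))
        valid))

module UniqueLists where

  open import Data.Nat as ℕ using (ℕ; suc; _+_; _*_; _≤_; z≤n; s≤s)
  import Data.Nat.Properties as ℕ
  open import Data.List using (List; []; _∷_; _++_; length; map; concatMap; cartesianProduct)
  open import Data.Nat.ListAction using (sum)
  open import Function using (_∘_)
  open import Data.List.Properties using (length-++; length-map)
  open import Data.List.Relation.Unary.All as All using (All; []; _∷_)
  import Data.List.Relation.Unary.All.Properties as All
  open import Data.List.Relation.Unary.Any using (here; there)
  open import Data.List.Relation.Unary.AllPairs using ([]; _∷_)
  open import Data.List.Membership.Propositional using (_∈_; find)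
  open import Data.List.Membership.Propositional.Properties
  open import Data.List.Relation.Binary.Subset.Propositional using (_⊆_)
  open import Data.List.Relation.Unary.Unique.Propositional using (Unique)
  import Data.List.Relation.Unary.Unique.Propositional.Properties as Unique
  open import Data.Product using (_×_; _,_)
  open import Data.Sum using (inj₁; inj₂)
  open import Data.Empty using (⊥-elim)
  open import Relation.Nullary using (¬_)
  open import Relation.Binary.PropositionalEquality


  module _ {A B : Set} where

    Unique-map⁺-on : ∀ {f : A → B} {xs} → (∀ {x y} → x ∈ xs → y ∈ xs → f x ≡ f y → x ≡ y) →
                     Unique xs → Unique (map f xs)
    Unique-map⁺-on {xs = []}     inj []         = []
    Unique-map⁺-on {xs = x ∷ xs} inj (x∉ ∷ xs!) =
      All.map⁺ (All.tabulate (λ y∈ fx≡fy → All.lookup x∉ y∈ (inj (here refl) (there y∈) fx≡fy)))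
      ∷ Unique-map⁺-on (λ x∈ y∈ → inj (there x∈) (there y∈)) xs!

    Unique-concatMap⁺ : ∀ (f : A → List B) (key : B → A) {xs} →
                        (∀ x {v} → v ∈ f x → key v ≡ x) → (∀ x → Unique (f x)) →
                        Unique xs → Unique (concatMap f xs)
    Unique-concatMap⁺ f key {[]}     keyed f! []         = []
    Unique-concatMap⁺ f key {x ∷ xs} keyed f! (x∉ ∷ xs!) =
      Unique.++⁺ (f! x) (Unique-concatMap⁺ f key keyed f! xs!) disjoint
      where
      disjoint : ∀ {v} → ¬ (v ∈ f x × v ∈ concatMap f xs)
      disjoint (v∈fx , v∈rest) with y , y∈ , v∈fy ← find (∈-concatMap⁻ f {xs = xs} v∈rest) =
        All.lookup x∉ y∈ (trans (sym (keyed x v∈fx)) (keyed y v∈fy))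

    length-concatMap : ∀ (f : A → List B) xs → length (concatMap f xs) ≡ sum (map (length ∘ f) xs)
    length-concatMap f []       = refl
    length-concatMap f (x ∷ xs) = trans (length-++ (f x)) (cong (length (f x) +_) (length-concatMap f xs))

    length-cartesianProduct : ∀ (xs : List A) (ys : List B) →
                              length (cartesianProduct xs ys) ≡ length xs * length ys
    length-cartesianProduct []       ys = refl
    length-cartesianProduct (x ∷ xs) ys =
      trans (length-++ (map (x ,_) ys)) (cong₂ _+_ (length-map (x ,_) ys) (length-cartesianProduct xs ys))


  module _ {A : Set} where

    Unique⇒length≤ : ∀ {xs ys : List A} → Unique xs → xs ⊆ ys → length xs ≤ length ys
    Unique⇒length≤ {[]}     _          _  = z≤n
    Unique⇒length≤ {x ∷ xs} (x∉ ∷ xs!) xs⊆ys with ys₁ , ys₂ , refl ← ∈-∃++ (xs⊆ys (here refl)) =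
      ℕ.≤-trans (s≤s (Unique⇒length≤ xs! xs⊆ys₁ys₂)) (ℕ.≤-reflexive (sym length-ys))
      where
      length-ys : length (ys₁ ++ x ∷ ys₂) ≡ suc (length (ys₁ ++ ys₂))
      length-ys = trans (length-++ ys₁) (trans (ℕ.+-suc (length ys₁) _) (cong suc (sym (length-++ ys₁))))
      xs⊆ys₁ys₂ : xs ⊆ ys₁ ++ ys₂
      xs⊆ys₁ys₂ z∈ with ∈-++⁻ ys₁ (xs⊆ys (there z∈))
      ... | inj₁ z∈₁         = ∈-++⁺ˡ z∈₁
      ... | inj₂ (here refl) = ⊥-elim (All.lookup x∉ z∈ refl)
      ... | inj₂ (there z∈₂) = ∈-++⁺ʳ ys₁ z∈₂

    Unique⇒length≡ : ∀ {xs ys : List A} → Unique xs → Unique ys → xs ⊆ ys → ys ⊆ xs →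
                     length xs ≡ length ys
    Unique⇒length≡ xs! ys! xs⊆ys ys⊆xs =
      ℕ.≤-antisym (Unique⇒length≤ xs! xs⊆ys) (Unique⇒length≤ ys! ys⊆xs)

module Decomposition where

  open import Data.Nat as ℕ using (ℕ; zero; suc; _+_; _*_; _∸_; _≤_; z≤n; s≤s)
  import Data.Nat.Properties as ℕ
  open import Data.List using (List; []; _∷_; _++_; length; map; concatMap; upTo; cartesianProduct)
  open import Data.List.Properties using (∷-injective; ∷-injectiveʳ; length-++; length-map; map-cong)
  open import Data.Nat.ListAction using (sum)
  open import Data.List.Relation.Binary.Subset.Propositional using (_⊆_)
  open import Data.Sum using (inj₁; inj₂)
  open import Data.Product using (∃₂; _×_; _,_; proj₁)
  open import Function using (_∘_)
  open import Data.List.Relation.Unary.Unique.Propositional using (Unique)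
  import Data.List.Relation.Unary.Unique.Propositional.Properties as Unique
  open import Data.List.Membership.Propositional using (_∈_; find)
  open import Data.List.Membership.Propositional.Properties
  import Data.List.Relation.Unary.Any as Any
  open import Data.Empty using (⊥-elim)
  open import Relation.Nullary using (¬_)
  open import Relation.Binary.PropositionalEquality
  open import Algebra.Properties.CommutativeSemigroup ℕ.+-commutativeSemigroup
    using () renaming (x∙yz≈y∙xz to m+[n+o]≡n+[m+o])
  open Capacities
  open UniqueLists

  -- The cut is at the first free position after which capacity r is left.
  capacity-split : ∀ {u b} r d → b ≤ r → Capacity u (suc r + d) b →
                   ∃₂ λ u₂ u₁ → u ≡ u₂ ++ 0 ∷ u₁ × Capacity u₂ d 0 × Capacity u₁ r b
  capacity-split r d b≤r empty = ⊥-elim (ℕ.<⇒≱ (s≤s (ℕ.m≤m+n r d)) b≤r)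
  capacity-split {0 ∷ u} {b} r zero    b≤r (free c) =
    [] , u , refl , empty , subst (λ x → Capacity u x b) (ℕ.+-identityʳ r) c
  capacity-split {0 ∷ u} {b} r (suc d) b≤r (free c)
    with u₂ , u₁ , refl , c₂ , c₁ ← capacity-split r d b≤r (subst (λ x → Capacity u x b) (ℕ.+-suc r d) c)
    = 0 ∷ u₂ , u₁ , refl , free c₂ , c₁
  capacity-split {suc j ∷ 0 ∷ u} {b} r d b≤r (peak j c)
    with u₂ , u₁ , refl , c₂ , c₁ ←
           capacity-split r (j + d) b≤r (subst (λ x → Capacity u x b) (m+[n+o]≡n+[m+o] j (suc r) d) c)
    = suc j ∷ 0 ∷ u₂ , u₁ , refl , peak j c₂ , c₁

  capacity-++-free : ∀ {u₂ u₁ d e} → Capacity u₂ d 0 → Capacity u₁ e 0 →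
                     Capacity (u₂ ++ 0 ∷ u₁) (suc e + d) 0
  capacity-++-free {e = e} c₂ c₁ =
    capacity-++ (subst (Capacity _ _) (ℕ.+-identityʳ (suc e)) (capacity-raise (suc e) c₂)) (free c₁)

  ¬capacity-++-free : ∀ {u₂ u₁ d e} → Capacity u₂ d 0 → Capacity u₁ e 0 →
                      ¬ Capacity (u₂ ++ 0 ∷ u₁) e 0
  ¬capacity-++-free {d = d} {e} c₂ c₁ c =
    ℕ.<⇒≢ (s≤s (ℕ.m≤m+n e d)) (capacity-unique c (capacity-++-free c₂ c₁))

  ++-free-injective : ∀ {t₂ s₂ t₁ s₁ d d′ e} → Capacity t₂ d 0 → Capacity s₂ d′ 0 →
                      Capacity t₁ e 0 → Capacity s₁ e 0 →
                      t₂ ++ 0 ∷ t₁ ≡ s₂ ++ 0 ∷ s₁ → t₂ ≡ s₂ × t₁ ≡ s₁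
  ++-free-injective empty empty ct cs eq = refl , ∷-injectiveʳ eq
  ++-free-injective empty (free c) ct cs eq
    with refl ← ∷-injectiveʳ eq = ⊥-elim (¬capacity-++-free c cs ct)
  ++-free-injective (free c) empty ct cs eq
    with refl ← ∷-injectiveʳ eq = ⊥-elim (¬capacity-++-free c ct cs)
  ++-free-injective (free c) (free c′) ct cs eq
    with refl , refl ← ++-free-injective c c′ ct cs (∷-injectiveʳ eq) = refl , refl
  ++-free-injective (peak j c) (peak j′ c′) ct cs eq
    with refl , eq′ ← ∷-injective eq
    with refl , refl ← ++-free-injective c c′ ct cs (∷-injectiveʳ eq′) = refl , refl

  peakJoin : List ℕ × List ℕ → List ℕ
  peakJoin (t₂ , t₁) = suc (suc (capacityOf t₁)) ∷ 0 ∷ t₂ ++ 0 ∷ t₁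

  peakJoin-capacity : ∀ {t₂ t₁ d e} → Capacity t₂ d 0 → Capacity t₁ e 0 →
                      Capacity (peakJoin (t₂ , t₁)) d 0
  peakJoin-capacity c₂ c₁ rewrite capacityOf-correct c₁ = peak _ (capacity-++-free c₂ c₁)

  U₁D∷_ : List ℕ → List ℕ
  U₁D∷ t = 1 ∷ 0 ∷ t

  splittingsAt : ℕ → ℕ → List (List ℕ × List ℕ)
  splittingsAt n i = cartesianProduct (signatures i) (signatures (n ∸ suc i))

  splittings : ℕ → List (List ℕ × List ℕ)
  splittings n = concatMap (splittingsAt n) (upTo n)

  decomposed : ℕ → List (List ℕ)
  decomposed n =
    map (0 ∷_) (signatures (suc n)) ++ map U₁D∷_ (signatures n) ++ map peakJoin (splittings n)

  ∈-splittings⁻ : ∀ n {t₂ t₁} → (t₂ , t₁) ∈ splittings n →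
                  length t₂ + suc (length t₁) ≡ n × Admissible t₂ × Admissible t₁
  ∈-splittings⁻ n t∈
    with i , i∈ , t∈i ← find (∈-concatMap⁻ (splittingsAt n) {xs = upTo n} t∈)
    with t₂∈ , t₁∈ ← ∈-cartesianProduct⁻ (signatures i) (signatures (n ∸ suc i)) t∈i
    with refl , a₂ ← ∈-signatures⁻ i t₂∈
    with l₁ , a₁ ← ∈-signatures⁻ (n ∸ suc i) t₁∈
    = trans (cong (λ l → i + suc l) l₁) (trans (ℕ.+-suc i _) (ℕ.m+[n∸m]≡n (∈-upTo⁻ i∈))) , a₂ , a₁

  ∈-splittings⁺ : ∀ {t₂ t₁} → Admissible t₂ → Admissible t₁ →
                  (t₂ , t₁) ∈ splittings (length t₂ + suc (length t₁))
  ∈-splittings⁺ {t₂} {t₁} a₂ a₁ =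
    ∈-concatMap⁺ (splittingsAt n) {xs = upTo n} (Any.map t∈ (∈-upTo⁺ (ℕ.m<m+n (length t₂) (s≤s z≤n))))
    where
    n = length t₂ + suc (length t₁)
    length-t₁ : length t₁ ≡ n ∸ suc (length t₂)
    length-t₁ = sym (trans (cong (_∸ suc (length t₂)) (ℕ.+-suc (length t₂) (length t₁)))
                           (ℕ.m+n∸m≡n (suc (length t₂)) (length t₁)))
    t∈ : ∀ {i} → length t₂ ≡ i → (t₂ , t₁) ∈ splittingsAt n i
    t∈ refl =
      ∈-cartesianProduct⁺ (∈-signatures⁺ a₂) (subst (λ k → t₁ ∈ signatures k) length-t₁ (∈-signatures⁺ a₁))

  ∈-decomposed⁻ : ∀ n {z} → z ∈ decomposed n → length z ≡ 2 + n × Admissible z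
  ∈-decomposed⁻ n z∈ with ∈-++⁻ (map (0 ∷_) (signatures (suc n))) z∈
  ... | inj₁ z∈₁ with t , t∈ , refl ← ∈-map⁻ (0 ∷_) z∈₁
                 with l , m , c ← ∈-signatures⁻ (suc n) t∈ = cong suc l , suc m , free c
  ... | inj₂ z∈′ with ∈-++⁻ (map U₁D∷_ (signatures n)) z∈′
  ... | inj₁ z∈₂ with t , t∈ , refl ← ∈-map⁻ U₁D∷_ z∈₂
                 with l , m , c ← ∈-signatures⁻ n t∈ = cong (2 +_) l , m , peak 0 c
  ... | inj₂ z∈₃ with (t₂ , t₁) , t∈ , refl ← ∈-map⁻ peakJoin z∈₃
                 with l , (d , c₂) , (e , c₁) ← ∈-splittings⁻ n t∈
    = cong (2 +_) (trans (length-++ t₂) l) , d , peakJoin-capacity c₂ c₁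

  ∈-decomposed⁺ : ∀ n {z} → length z ≡ 2 + n → Admissible z → z ∈ decomposed n
  ∈-decomposed⁺ n {0 ∷ t} l (suc m , free c) =
    ∈-++⁺ˡ (∈-map⁺ (0 ∷_) (subst (λ k → t ∈ signatures k) (ℕ.suc-injective l) (∈-signatures⁺ (m , c))))
  ∈-decomposed⁺ n {1 ∷ 0 ∷ t} l (m , peak 0 c) =
    ∈-++⁺ʳ (map (0 ∷_) (signatures (suc n))) (∈-++⁺ˡ (∈-map⁺ U₁D∷_
      (subst (λ k → t ∈ signatures k) (ℕ.suc-injective (ℕ.suc-injective l)) (∈-signatures⁺ (m , c)))))
  ∈-decomposed⁺ n {suc (suc e) ∷ 0 ∷ t} l (m , peak (suc e) c)
    with t₂ , t₁ , refl , c₂ , c₁ ← capacity-split e m z≤n c =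
    ∈-++⁺ʳ (map (0 ∷_) (signatures (suc n))) (∈-++⁺ʳ (map U₁D∷_ (signatures n))
      (subst₂ _∈_ (cong (λ k → suc (suc k) ∷ 0 ∷ t₂ ++ 0 ∷ t₁) (capacityOf-correct c₁))
                  (cong (map peakJoin ∘ splittings)
                        (trans (sym (length-++ t₂)) (ℕ.suc-injective (ℕ.suc-injective l))))
                  (∈-map⁺ peakJoin (∈-splittings⁺ (m , c₂) (e , c₁)))))

  splittings-unique : ∀ n → Unique (splittings n)
  splittings-unique n =
    Unique-concatMap⁺ (splittingsAt n) (length ∘ proj₁) length-t₂
      (λ i → Unique.cartesianProduct⁺ (signatures-unique i) (signatures-unique (n ∸ suc i)))
      (Unique.upTo⁺ n)
    where
    length-t₂ : ∀ i {t} → t ∈ splittingsAt n i → length (proj₁ t) ≡ i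
    length-t₂ i t∈ = proj₁ (∈-signatures⁻ i (proj₁ (∈-cartesianProduct⁻ (signatures i) _ t∈)))

  peakJoin-injective : ∀ n {x y} → x ∈ splittings n → y ∈ splittings n →
                       peakJoin x ≡ peakJoin y → x ≡ y
  peakJoin-injective n {t₂ , t₁} {s₂ , s₁} x∈ y∈ eq
    with _ , (_ , ct₂) , (_ , ct₁) ← ∈-splittings⁻ n x∈
    with _ , (_ , cs₂) , (_ , cs₁) ← ∈-splittings⁻ n y∈
    with head , tail ← ∷-injective eq
    with refl ← trans (sym (capacityOf-correct ct₁))
                      (trans (ℕ.suc-injective (ℕ.suc-injective head)) (capacityOf-correct cs₁))
    with refl , refl ← ++-free-injective ct₂ cs₂ ct₁ cs₁ (∷-injectiveʳ tail)
    = refl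

  decomposed-unique : ∀ n → Unique (decomposed n)
  decomposed-unique n =
    Unique.++⁺ (Unique.map⁺ ∷-injectiveʳ (signatures-unique (suc n)))
      (Unique.++⁺ (Unique.map⁺ (∷-injectiveʳ ∘ ∷-injectiveʳ) (signatures-unique n))
                  (Unique-map⁺-on (peakJoin-injective n) (splittings-unique n))
                  disjoint₂₃)
      disjoint₁
    where
    disjoint₂₃ : ∀ {v} → ¬ (v ∈ map U₁D∷_ (signatures n) × v ∈ map peakJoin (splittings n))
    disjoint₂₃ (v∈₂ , v∈₃) with _ , _ , refl ← ∈-map⁻ _ v∈₂ | _ , _ , () ← ∈-map⁻ peakJoin v∈₃
    disjoint₁ : ∀ {v} → ¬ (v ∈ map (0 ∷_) (signatures (suc n)) ×
                           v ∈ map U₁D∷_ (signatures n) ++ map peakJoin (splittings n))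
    disjoint₁ (v∈₁ , v∈₂₃) with _ , _ , refl ← ∈-map⁻ _ v∈₁ | ∈-++⁻ (map U₁D∷_ (signatures n)) v∈₂₃
    ... | inj₁ v∈₂ with _ , _ , () ← ∈-map⁻ _ v∈₂
    ... | inj₂ v∈₃ with _ , _ , () ← ∈-map⁻ peakJoin v∈₃

  length-decomposed : ∀ n → length (decomposed n) ≡
                            c (suc n) + (c n + sum (map (λ i → c i * c (n ∸ suc i)) (upTo n)))
  length-decomposed n = begin
    length (decomposed n)
      ≡⟨ length-++ (map (0 ∷_) (signatures (suc n))) ⟩
    length (map (0 ∷_) (signatures (suc n)))
      + length (map U₁D∷_ (signatures n) ++ map peakJoin (splittings n))
      ≡⟨ cong₂ _+_ (length-map _ (signatures (suc n))) (length-++ (map U₁D∷_ (signatures n))) ⟩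
    c (suc n) + (length (map U₁D∷_ (signatures n)) + length (map peakJoin (splittings n)))
      ≡⟨ cong (c (suc n) +_) (cong₂ _+_ (length-map _ (signatures n)) (length-map peakJoin (splittings n))) ⟩
    c (suc n) + (c n + length (splittings n))
      ≡⟨ cong (λ k → c (suc n) + (c n + k)) length-splittings ⟩
    c (suc n) + (c n + sum (map (λ i → c i * c (n ∸ suc i)) (upTo n))) ∎
    where
    open ≡-Reasoning
    length-splittings : length (splittings n) ≡ sum (map (λ i → c i * c (n ∸ suc i)) (upTo n))
    length-splittings =
      trans (length-concatMap (splittingsAt n) (upTo n))
            (cong sum (map-cong (λ i → length-cartesianProduct (signatures i) _) (upTo n)))

  c-recurrence : ∀ n → c (2 + n) ≡ c (suc n) + (c n + sum (map (λ i → c i * c (n ∸ suc i)) (upTo n)))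
  c-recurrence n =
    trans (Unique⇒length≡ (signatures-unique (2 + n)) (decomposed-unique n) signatures⊆ decomposed⊆)
          (length-decomposed n)
    where
    signatures⊆ : signatures (2 + n) ⊆ decomposed n
    signatures⊆ z∈ = let l , a = ∈-signatures⁻ (2 + n) z∈ in ∈-decomposed⁺ n l a
    decomposed⊆ : decomposed n ⊆ signatures (2 + n)
    decomposed⊆ {z} z∈ =
      let l , a = ∈-decomposed⁻ n z∈ in subst (λ k → z ∈ signatures k) l (∈-signatures⁺ a)

module Recurrences where

  open import Data.Nat as ℕ using (ℕ; zero; suc; _+_; _*_; _∸_; _≤_; _<_; z≤n; s≤s)
  import Data.Nat.Properties as ℕ
  open import Data.Nat.ListAction using (sum)
  open import Data.Nat.ListAction.Properties using (sum-++)
  open import Data.List using (List; []; _∷_; _++_; [_]; length; map; upTo; _∷ʳ_)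
  open import Data.List.Properties using (length-++; map-++; map-∘; map-cong-local; upTo-∷ʳ)
  open import Data.List.Relation.Unary.All as All using (All)
  open import Data.List.Membership.Propositional.Properties using (∈-upTo⁻; ∈-map⁻)
  open import Data.List.Membership.Propositional using (_∈_)
  open import Data.Sum using (inj₁; inj₂)
  open import Data.Product using (_,_)
  open import Function using (_∘_)
  open import Data.Nat.Induction using (<-rec)
  open import Relation.Binary.PropositionalEquality hiding ([_])
  open Decomposition using (c-recurrence)

  length-prefix : ∀ m → length (prefix m) ≡ suc m
  length-prefix zero    = refl
  length-prefix (suc m) =
    trans (length-++ (prefix m)) (trans (ℕ.+-comm (length (prefix m)) 1) (cong suc (length-prefix m)))

  nth-++ˡ : ∀ (l r : List ℕ) {i} → i < length l → nth (l ++ r) i ≡ nth l i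
  nth-++ˡ (x ∷ l) r {zero}  _         = refl
  nth-++ˡ (x ∷ l) r {suc i} (s≤s i<l) = nth-++ˡ l r i<l

  nth-∷ʳ : ∀ (l : List ℕ) x → nth (l ∷ʳ x) (length l) ≡ x
  nth-∷ʳ []      x = refl
  nth-∷ʳ (y ∷ l) x = nth-∷ʳ l x

  nth-prefix : ∀ m {i} → i ≤ m → nth (prefix m) i ≡ a i
  nth-prefix zero    {zero} z≤n = refl
  nth-prefix (suc m) {i}    i≤1+m with ℕ.m≤n⇒m<n∨m≡n i≤1+m
  ... | inj₂ refl       = refl
  ... | inj₁ (s≤s i≤m) =
    trans (nth-++ˡ (prefix m) _ (subst (i <_) (sym (length-prefix m)) (s≤s i≤m))) (nth-prefix m i≤m)

  a-recurrence : ∀ m → a (suc m) ≡ a m + sum (map (λ k → a k * a (m ∸ 1 ∸ k)) (map suc (upTo (m ∸ 1))))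
  a-recurrence m =
    trans (subst (λ j → nth (prefix m ∷ʳ next m (prefix m)) j ≡ next m (prefix m)) (length-prefix m)
                 (nth-∷ʳ (prefix m) _))
          (cong₂ _+_ (nth-prefix m ℕ.≤-refl) (cong sum (map-cong-local (All.tabulate bounded))))
    where
    bounded : ∀ {k} → k ∈ map suc (upTo (m ∸ 1)) →
              nth (prefix m) k * nth (prefix m) (m ∸ 1 ∸ k) ≡ a k * a (m ∸ 1 ∸ k)
    bounded k∈ with i , i∈ , refl ← ∈-map⁻ suc k∈ =
      cong₂ _*_ (nth-prefix m (ℕ.≤-trans (∈-upTo⁻ i∈) (ℕ.m∸n≤m m 1)))
                (nth-prefix m (ℕ.≤-trans (ℕ.m∸n≤m (m ∸ 1) (suc i)) (ℕ.m∸n≤m m 1)))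

  a-recurrence-shifted : ∀ n →
    a (3 + n) ≡ a (2 + n) + (a (1 + n) + sum (map (λ i → a (suc i) * a (n ∸ i)) (upTo n)))
  a-recurrence-shifted n = begin
    a (3 + n)
      ≡⟨ a-recurrence (2 + n) ⟩
    a (2 + n) + sum (map F (map suc (upTo (suc n))))
      ≡⟨ cong (λ xs → a (2 + n) + sum xs) (sym (map-∘ (upTo (suc n)))) ⟩
    a (2 + n) + sum (map (F ∘ suc) (upTo (suc n)))
      ≡⟨ cong (λ xs → a (2 + n) + sum (map (F ∘ suc) xs)) (sym (upTo-∷ʳ n)) ⟩
    a (2 + n) + sum (map (F ∘ suc) (upTo n ∷ʳ n))
      ≡⟨ cong (λ xs → a (2 + n) + sum xs) (map-++ (F ∘ suc) (upTo n) [ n ]) ⟩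
    a (2 + n) + sum (map (F ∘ suc) (upTo n) ++ [ F (suc n) ])
      ≡⟨ cong (a (2 + n) +_) (sum-++ (map (F ∘ suc) (upTo n)) [ F (suc n) ]) ⟩
    a (2 + n) + (S + (F (suc n) + 0))
      ≡⟨ cong (λ k → a (2 + n) + (S + k)) last-term ⟩
    a (2 + n) + (S + a (1 + n))
      ≡⟨ cong (a (2 + n) +_) (ℕ.+-comm S (a (1 + n))) ⟩
    a (2 + n) + (a (1 + n) + S) ∎
    where
    open ≡-Reasoning
    F : ℕ → ℕ
    F k = a k * a (suc n ∸ k)
    S : ℕ
    S = sum (map (F ∘ suc) (upTo n))
    last-term : F (suc n) + 0 ≡ a (1 + n)
    last-term = trans (ℕ.+-identityʳ _) (trans (cong (λ j → a (suc n) * a j) (ℕ.n∸n≡0 n)) (ℕ.*-identityʳ _))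

  c≡a : ∀ n → c n ≡ a (suc n)
  c≡a = <-rec _ step
    where
    step : ∀ n → (∀ {m} → m < n → c m ≡ a (suc m)) → c n ≡ a (suc n)
    step 0             _  = refl
    step 1             _  = refl
    step (suc (suc n)) ih = begin
      c (2 + n)
        ≡⟨ c-recurrence n ⟩
      c (1 + n) + (c n + sum (map (λ i → c i * c (n ∸ suc i)) (upTo n)))
        ≡⟨ cong₂ _+_ (ih ℕ.≤-refl)
                     (cong₂ _+_ (ih (ℕ.m≤n⇒m≤1+n ℕ.≤-refl))
                                (cong sum (map-cong-local (All.tabulate products)))) ⟩
      a (2 + n) + (a (1 + n) + sum (map (λ i → a (suc i) * a (n ∸ i)) (upTo n)))
        ≡⟨ a-recurrence-shifted n ⟨
      a (3 + n) ∎
      where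
      open ≡-Reasoning
      products : ∀ {i} → i ∈ upTo n → c i * c (n ∸ suc i) ≡ a (suc i) * a (n ∸ i)
      products {i} i∈ =
        cong₂ _*_ (ih (ℕ.m≤n⇒m≤o+n 2 (∈-upTo⁻ i∈)))
                  (trans (ih (s≤s (ℕ.m≤n⇒m≤1+n (ℕ.m∸n≤m n (suc i)))))
                         (cong a (sym (ℕ.+-∸-assoc 1 (∈-upTo⁻ i∈)))))

module GeneratingFunction where

  open PowerSeries
  open QuadraticEquation using (1-x-x²; recurrence⇒equation)
  open Decomposition using (c-recurrence)
  open import Data.Nat as ℕ using (ℕ; suc)
  open import Data.Nat.ListAction using (sum)
  open import Data.Integer using (+_; _+_)
  import Data.Integer.Properties as ℤ
  open import Data.List using (map; upTo; applyUpTo)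
  open import Data.List.Properties using (map-upTo)
  open import Function using (_∘_)
  open import Relation.Binary.PropositionalEquality

  C-recurrence : ∀ m → C (3 ℕ.+ m) ≡ C (2 ℕ.+ m) + C (1 ℕ.+ m) + (C ⋆ C) m
  C-recurrence m = begin
    + c (3 ℕ.+ m)
      ≡⟨ cong +_ (c-recurrence (suc m)) ⟩
    + (c (2 ℕ.+ m) ℕ.+ (c (1 ℕ.+ m) ℕ.+ total))
      ≡⟨ ℤ.pos-+ (c (2 ℕ.+ m)) _ ⟩
    C (2 ℕ.+ m) + + (c (1 ℕ.+ m) ℕ.+ total)
      ≡⟨ cong (_+_ (C (2 ℕ.+ m))) (ℤ.pos-+ (c (1 ℕ.+ m)) _) ⟩
    C (2 ℕ.+ m) + (C (1 ℕ.+ m) + + total)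
      ≡⟨ ℤ.+-assoc (C (2 ℕ.+ m)) (C (1 ℕ.+ m)) (+ total) ⟨
    C (2 ℕ.+ m) + C (1 ℕ.+ m) + + total
      ≡⟨ cong (λ k → C (2 ℕ.+ m) + C (1 ℕ.+ m) + k) convolution ⟩
    C (2 ℕ.+ m) + C (1 ℕ.+ m) + (C ⋆ C) m ∎
    where
    open ≡-Reasoning
    products : ℕ → ℕ
    products i = c i ℕ.* c (m ℕ.∸ i)
    total : ℕ
    total = sum (map products (upTo (suc m)))
    convolution : + total ≡ (C ⋆ C) m
    convolution = begin
      + total                              ≡⟨ cong (+_ ∘ sum) (map-upTo products (suc m)) ⟩
      + sum (applyUpTo products (suc m))   ≡⟨ sumTo-applyUpTo m products ⟨
      sumTo m (+_ ∘ products)              ≡⟨ sumTo-cong m (λ i _ → ℤ.pos-* (c i) (c (m ℕ.∸ i))) ⟩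
      (C ⋆ C) m                            ∎

  C-equation : 1-x-x² ⋆ₚ C ≗ (one ⊕ shift³ (C ⋆ C))
  C-equation = recurrence⇒equation C refl refl refl C-recurrence

open import Data.Nat using (ℕ; suc)
open import Data.Integer using (+_)
open import Data.Product using (Σ; _×_; _,_)
open import Relation.Binary.PropositionalEquality using (_≡_; refl)

open GeneratingFunction using (C-equation)
open QuadraticEquation.QuadraticSolution C C-equation
open Recurrences using (c≡a)

theorem8 :
    Σ Series (λ S →
        (S 0 ≡ + 1)
      × (∀ n → (S ⋆ S) n ≡ radicand n)
      × (∀ n → (C ⋆ (denPoly ⊕ (oneMinusX ⋆ S))) n ≡ (numPoly ⊕ S) n))
    × (∀ n → c n ≡ a (suc n))
theorem8 = (root , refl , root-squared , root-equation) , c≡a
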